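{- Let $p$ be the partially ordered pattern of length $4$ on the labels $\{1,2,3,4\}$ whose only relations are $1>2$ and $1>3$ (label $4$ is incomparable to all others, and $2,3$ are incomparable). Let $a(n)$ be the number of $n$-permutations avoiding $p$. Then $a(0)=a(1)=1$ and $a(n)=n2^{n-2}$ for $n>1$. Also, $$\sum_{n\geq 0}a(n)x^n=\frac{1-3x+2x^2+2x^3}{(1-2x)^2}.$$
   Context: An $n$-permutation is a permutation $\pi=\pi_1\cdots\pi_n$ of $\{1,\dots,n\}$ written in one-line notation (for $n=0$ there is exactly one, the empty permutation). A partially ordered pattern (POP) $p$ of length $k$ is a partial order $<_P$ on the label set $\{1,\dots,k\}$. An occurrence of $p$ in $\pi$ is a subsequence $\pi_{i_1}\pi_{i_2}\cdots\pi_{i_k}$ with $1\leq i_1<\cdots<i_k\leq n$ such that $\pi_{i_j}<\pi_{i_m}$ whenever $j<_P m$ (no condition is imposed on pairs of incomparable labels). A permutation avoids $p$ if it contains no occurrence of $p$. -}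

module Defs where

open import Data.Nat using (ℕ; zero; suc; _∸_)
open import Data.Fin using (Fin; _<_; _<?_)
open import Data.Fin.Properties using (any?; all?; _≟_)
open import Data.Vec using (Vec; []; _∷_; lookup)
open import Data.List using (List; []; _∷_; [_]; map; concatMap; allFin; filter; length; foldr; upTo)
open import Data.Product using (Σ; ∃; _×_; _,_)
open import Data.Integer as ℤ using (ℤ; +_)
open import Relation.Nullary using (Dec; ¬_; yes; no)
open import Relation.Nullary.Decidable using (_×-dec_; ¬?)
open import Relation.Binary.PropositionalEquality using (_≡_)

-- An n-permutation in one-line notation: a vector π₁⋯πₙ of values in
-- {0,…,n-1} (i.e. {1,…,n} shifted by one) whose entries are pairwise distinct.
IsPerm : ∀ {n} → Vec (Fin n) n → Set
IsPerm {n} π = ∀ (i j : Fin n) → lookup π i ≡ lookup π j → i ≡ j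

isPerm? : ∀ {n} (π : Vec (Fin n) n) → Dec (IsPerm π)
isPerm? π = all? λ i → all? λ j → Relation.Nullary.Decidable.map′
  (λ f e → f e) (λ f e → f e) (dec→ (lookup π i Data.Fin.Properties.≟ lookup π j) (i ≟ j))
  where
  dec→ : ∀ {A B : Set} → Dec A → Dec B → Dec (A → B)
  dec→ (yes a) (yes b) = yes (λ _ → b)
  dec→ (yes a) (no ¬b) = no (λ f → ¬b (f a))
  dec→ (no ¬a) _ = yes (λ a → Data.Empty.⊥-elim (¬a a))
    where import Data.Empty

Occurrence : ∀ {n} → Vec (Fin n) n → Set
Occurrence {n} π =
  ∃ λ (i₁ : Fin n) → ∃ λ (i₂ : Fin n) → ∃ λ (i₃ : Fin n) → ∃ λ (i₄ : Fin n) →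
    (i₁ < i₂) × (i₂ < i₃) × (i₃ < i₄) ×
    (lookup π i₂ < lookup π i₁) × (lookup π i₃ < lookup π i₁)

occurrence? : ∀ {n} (π : Vec (Fin n) n) → Dec (Occurrence π)
occurrence? π = any? λ i₁ → any? λ i₂ → any? λ i₃ → any? λ i₄ →
  (i₁ <? i₂) ×-dec (i₂ <? i₃) ×-dec (i₃ <? i₄) ×-dec
  (lookup π i₂ <? lookup π i₁) ×-dec (lookup π i₃ <? lookup π i₁)

Avoids : ∀ {n} → Vec (Fin n) n → Set
Avoids π = ¬ Occurrence π

allVecs : ∀ k n → List (Vec (Fin n) k)
allVecs zero    n = [ [] ]
allVecs (suc k) n = concatMap (λ x → map (x ∷_) (allVecs k n)) (allFin n)

a : ℕ → ℕ
a n = length (filter (λ π → isPerm? π ×-dec ¬? (occurrence? π)) (allVecs n n))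

FPS : Set
FPS = ℕ → ℤ

_⊛_ : FPS → FPS → FPS
(f ⊛ g) n = foldr ℤ._+_ (+ 0) (map (λ k → f k ℤ.* g (n ∸ k)) (upTo (suc n)))

-- Polynomial given by its list of coefficients (constant term first).
poly : List ℤ → FPS
poly []       n       = + 0
poly (c ∷ cs) zero    = c
poly (c ∷ cs) (suc n) = poly cs n

A : FPS
A n = + (a n)

-- Write a permutation as w l, l its last entry. In an occurrence of p the last entry can
-- only play the unconstrained label 4, so w l avoids p exactly when every entry of w has
-- at most one smaller entry after it in w. Such a w lists the n - 1 values other than l,
-- each entry being one of the two smallest values not listed before it: two choices at
-- every step but the last. With n choices of l this gives a(n) = n 2^(n-2), and the
-- generating function follows from a(n) - 4 a(n-1) + 4 a(n-2) = 0 for n >= 4.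

module Submission where

open import Defs

open import Data.Bool using (Bool; true; false; not; _∧_; _∨_; T)
open import Data.Bool.Properties
  using ( T-≡; T-∧; ∧-assoc; ∨-identityʳ; ∧-identityʳ; ∧-zeroʳ; not-involutive
        ; ∧-commutativeMonoid; ∨-∧-booleanAlgebra)
open import Data.Fin using (Fin; zero; suc; fromℕ<; _<_; _<?_)
open import Data.Fin.Properties using (_≟_; <⇒≢; toℕ<n)
open import Data.Integer as ℤ using (ℤ; +_; -[1+_])
import Data.Integer.Properties as ℤ
import Data.Integer.Tactic.RingSolver as ℤ-Solver
open import Data.List using (List; []; _∷_; _++_; map; concatMap; filter; length; tabulate; foldr; applyUpTo)
open import Data.List.Properties using (filter-++; length-++)
import Data.Nat as ℕ
open import Data.Nat using (ℕ; zero; suc; _+_; _*_; _∸_; _^_; _⊓_; _≤_; _<ᵇ_; z≤n; s≤s)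
open import Data.Nat.Properties
  using ( +-*-semiring; +-commutativeSemigroup; +-identityʳ; +-mono-≤; ≤-refl; ≤-<-trans
        ; *-identityʳ; ⊓-zeroʳ; suc-injective; n≤0⇒n≡0)
import Data.Nat.Tactic.RingSolver as ℕ-Solver
open import Data.Product using (_×_; _,_; ∃)
open import Data.Sum using (_⊎_; inj₁; inj₂)
open import Data.Unit using (⊤; tt)
open import Data.Vec using (Vec; []; _∷_; _∷ʳ_; lookup; count)
open import Data.Vec.Properties using (tabulate∘lookup)
open import Data.Vec.Relation.Unary.All as All using (All; []; _∷_; all?)
open import Data.Vec.Relation.Unary.Unique.Propositional using (Unique; []; _∷_)
open import Data.Vec.Relation.Unary.AllPairs using (allPairs?)
open import Data.Vec.Relation.Unary.Unique.Propositional.Properties using (tabulate⁺; lookup-injective)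
open import Function using (_∘_; _⇔_; mk⇔; Equivalence)
open import Level using (0ℓ)
open import Relation.Nullary using (¬_; Dec; yes; no; does; _×-dec_; _⊎-dec_; ¬?; T?)
open import Relation.Nullary.Decidable using (dec-false; does-≡; does-⇔) renaming (map to map-dec)
open import Relation.Unary using (Pred; Decidable)
open import Relation.Binary.PropositionalEquality
  using (_≡_; _≢_; _≗_; refl; sym; trans; cong; cong₂; subst; module ≡-Reasoning)
open ≡-Reasoning

open import Algebra.Properties.Semiring.Sum +-*-semiring
  using (sum-syntax; sum-cong-≗; ∑-comm; sum-replicate-zero; *-distribʳ-sum)
open import Algebra.Properties.CommutativeSemigroup +-commutativeSemigroup using (x∙yz≈y∙xz)
import Algebra.Properties.CommutativeSemigroup
open import Algebra.Bundles using (module CommutativeMonoid)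
module ∧ = Algebra.Properties.CommutativeSemigroup (CommutativeMonoid.commutativeSemigroup ∧-commutativeMonoid)
open import Algebra.Lattice.Properties.BooleanAlgebra ∨-∧-booleanAlgebra using (deMorgan₁)

-- Counting words

fromBool : Bool → ℕ
fromBool false = 0
fromBool true  = 1

∑-const : ∀ n c → ∑[ i < n ] c ≡ n * c
∑-const zero    c = refl
∑-const (suc n) c = cong (_+_ c) (∑-const n c)

card : ∀ {n} k → (Vec (Fin n) k → Bool) → ℕ
card     zero    f = fromBool (f [])
card {n} (suc k) f = ∑[ x < n ] card k (f ∘ (x ∷_))

card-cong : ∀ {n} k {f g : Vec (Fin n) k → Bool} → f ≗ g → card k f ≡ card k g
card-cong zero    f≗g = cong fromBool (f≗g [])
card-cong (suc k) f≗g = sum-cong-≗ λ x → card-cong k (f≗g ∘ (x ∷_))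

card-∷ʳ : ∀ {n} k (f : Vec (Fin n) (suc k) → Bool) →
          card (suc k) f ≡ ∑[ l < n ] card k (λ w → f (w ∷ʳ l))
card-∷ʳ     zero    f = refl
card-∷ʳ {n} (suc k) f = trans (sum-cong-≗ λ x → card-∷ʳ k (f ∘ (x ∷_))) (∑-comm {n} {n} _)

card-false : ∀ {n} k → card {n} k (λ _ → false) ≡ 0
card-false zero        = refl
card-false {n} (suc k) = trans (sum-cong-≗ {n} λ _ → card-false k) (sum-replicate-zero n)

card-∧ˡ : ∀ {n} k b (f : Vec (Fin n) k → Bool) → card k (λ w → b ∧ f w) ≡ fromBool b * card k f
card-∧ˡ k false f = card-false k
card-∧ˡ k true  f = sym (+-identityʳ (card k f))

module _ {A : Set} {P : Pred A 0ℓ} (P? : Decidable P) where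

  length-filter-map : ∀ {B : Set} (g : B → A) xs →
                      length (filter P? (map g xs)) ≡ length (filter (P? ∘ g) xs)
  length-filter-map g []       = refl
  length-filter-map g (x ∷ xs) with does (P? (g x))
  ... | true  = cong suc (length-filter-map g xs)
  ... | false = length-filter-map g xs

  length-filter-concatMap : ∀ {B : Set} {m} (h : B → List A) (f : Fin m → B) →
    length (filter P? (concatMap h (tabulate f))) ≡ ∑[ i < m ] length (filter P? (h (f i)))
  length-filter-concatMap {m = zero}  h f = refl
  length-filter-concatMap {m = suc m} h f = begin
    length (filter P? (h (f zero) ++ rest))           ≡⟨ cong length (filter-++ P? (h (f zero)) rest) ⟩
    length (filter P? (h (f zero)) ++ filter P? rest) ≡⟨ length-++ (filter P? (h (f zero))) ⟩
    _                                                 ≡⟨ cong (_+_ _) (length-filter-concatMap h (f ∘ suc)) ⟩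
    _                                                 ∎
    where
    rest = concatMap h (tabulate (f ∘ suc))

length-filter-allVecs : ∀ k n {P : Pred (Vec (Fin n) k) 0ℓ} (P? : Decidable P) →
                        length (filter P? (allVecs k n)) ≡ card k (does ∘ P?)
length-filter-allVecs zero    n P? with does (P? [])
... | true  = refl
... | false = refl
length-filter-allVecs (suc k) n P? = trans
  (length-filter-concatMap P? (λ x → map (x ∷_) (allVecs k n)) (λ x → x))
  (sum-cong-≗ λ x → trans (length-filter-map P? (x ∷_) (allVecs k n))
                          (length-filter-allVecs k n (P? ∘ (x ∷_))))

-- Subsets of Fin n

Subset : ℕ → Set
Subset n = Fin n → Bool

full : ∀ {n} → Subset n
full _ = true

infixr 7 _∩_
infixl 6 _∖_

_∩_ : ∀ {n} → Subset n → Subset n → Subset n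
(U ∩ V) x = U x ∧ V x

_∖_ : ∀ {n} → Subset n → Fin n → Subset n
(U ∖ x) y = not (does (x ≟ y)) ∧ U y

∣_∣ : ∀ {n} → Subset n → ℕ
∣_∣ {n} U = ∑[ x < n ] fromBool (U x)

rank : ∀ {n} → Subset n → Fin n → ℕ
rank U x = ∣ (λ y → does (y <? x)) ∩ U ∣

∣full∣ : ∀ n → ∣ full {n} ∣ ≡ n
∣full∣ n = trans (∑-const n 1) (*-identityʳ n)

∣∣-∖ : ∀ {n} (U : Subset n) y → ∣ U ∣ ≡ fromBool (U y) + ∣ U ∖ y ∣
∣∣-∖ {suc n} U zero    = refl
∣∣-∖ {suc n} U (suc y) = trans (cong (_+_ (fromBool (U zero))) (∣∣-∖ (U ∘ suc) y))
                               (x∙yz≈y∙xz (fromBool (U zero)) (fromBool (U (suc y))) _)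

∣∣-∖-∈ : ∀ {n} (U : Subset n) {y} → T (U y) → ∣ U ∣ ≡ suc ∣ U ∖ y ∣
∣∣-∖-∈ U {y} y∈U = trans (∣∣-∖ U y) (cong (λ b → fromBool b + ∣ U ∖ y ∣) (Equivalence.to T-≡ y∈U))

∣∩∣≤ : ∀ {n} (P U : Subset n) → ∣ P ∩ U ∣ ≤ ∣ U ∣
∣∩∣≤ {zero}  P U = z≤n
∣∩∣≤ {suc n} P U = +-mono-≤ (head≤ (P zero) (U zero)) (∣∩∣≤ (P ∘ suc) (U ∘ suc))
  where
  head≤ : ∀ p u → fromBool (p ∧ u) ≤ fromBool u
  head≤ false u = z≤n
  head≤ true  u = ≤-refl

rank-zero : ∀ {n} (U : Subset (suc n)) → rank U zero ≡ 0
rank-zero {n} U = sum-replicate-zero n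

∣rank<∣ : ∀ {n} (U : Subset n) r → ∣ U ∩ (λ x → rank U x <ᵇ r) ∣ ≡ ∣ U ∣ ⊓ r
∣rank<∣ {zero}  U r = refl
∣rank<∣ {suc n} U r with U zero
... | false = ∣rank<∣ (U ∘ suc) r
... | true  with r
...   | zero  = trans (∣rank<∣ (U ∘ suc) 0) (⊓-zeroʳ ∣ U ∘ suc ∣)
...   | suc r = cong₂ _+_ (cong (λ k → fromBool (k <ᵇ suc r)) (rank-zero U)) (∣rank<∣ (U ∘ suc) r)

-- Arrangements of a subset

module _ {n : ℕ} where

  countBelow : ∀ {k} → Fin n → Vec (Fin n) k → ℕ
  countBelow x = count (_<? x)

  AtMostOneBelow : ∀ {k} → Vec (Fin n) k → Set
  AtMostOneBelow []      = ⊤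
  AtMostOneBelow (x ∷ w) = countBelow x w ℕ.< 2 × AtMostOneBelow w

  atMostOneBelow? : ∀ {k} (w : Vec (Fin n) k) → Dec (AtMostOneBelow w)
  atMostOneBelow? []      = yes tt
  atMostOneBelow? (x ∷ w) = countBelow x w ℕ.<? 2 ×-dec atMostOneBelow? w

  unique? : ∀ {k} (w : Vec (Fin n) k) → Dec (Unique w)
  unique? = allPairs? (λ x y → ¬? (x ≟ y))

  Arrangement : ∀ {k} → Subset n → Vec (Fin n) k → Set
  Arrangement U w = Unique w × All (T ∘ U) w × AtMostOneBelow w

  arrangement? : ∀ {k} (U : Subset n) (w : Vec (Fin n) k) → Dec (Arrangement U w)
  arrangement? U w = unique? w ×-dec all? (T? ∘ U) w ×-dec atMostOneBelow? w

count-∷ : ∀ {n k} {P : Pred (Fin n) 0ℓ} (P? : Decidable P) y (w : Vec (Fin n) k) →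
          count P? (y ∷ w) ≡ fromBool (does (P? y)) + count P? w
count-∷ P? y w with does (P? y)
... | true  = refl
... | false = refl

T-not-does : ∀ {A : Set} (a? : Dec A) → T (not (does a?)) ⇔ (¬ A)
T-not-does (yes a) = mk⇔ (λ ()) (λ ¬a → ¬a a)
T-not-does (no ¬a) = mk⇔ (λ _ → ¬a) (λ _ → tt)

T-∖ : ∀ {n} (U : Subset n) x y → T ((U ∖ x) y) ⇔ (x ≢ y × T (U y))
T-∖ U x y = mk⇔
  (λ t → let (x≢y , y∈U) = Equivalence.to T-∧ t in Equivalence.to (T-not-does (x ≟ y)) x≢y , y∈U)
  (λ (x≢y , y∈U) → Equivalence.from T-∧ (Equivalence.from (T-not-does (x ≟ y)) x≢y , y∈U))

All-∖ : ∀ {n k} (U : Subset n) x (w : Vec (Fin n) k) →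
        All (T ∘ (U ∖ x)) w ⇔ (All (x ≢_) w × All (T ∘ U) w)
All-∖ U x w = mk⇔ (All.unzip ∘ All.map (Equivalence.to (T-∖ U x _)))
                  (All.map (Equivalence.from (T-∖ U x _)) ∘ All.zip)

count≡∣∩∣ : ∀ {n k} {P : Pred (Fin n) 0ℓ} (P? : Decidable P) (V : Subset n) (w : Vec (Fin n) k) →
            Unique w → All (T ∘ V) w → ∣ V ∣ ≡ k → count P? w ≡ ∣ (does ∘ P?) ∩ V ∣
count≡∣∩∣ P? V []      _ _ ∣V∣≡0 =
  sym (n≤0⇒n≡0 (subst (∣ (does ∘ P?) ∩ V ∣ ≤_) ∣V∣≡0 (∣∩∣≤ (does ∘ P?) V)))
count≡∣∩∣ P? V (y ∷ w) (y∉w ∷ uw) (y∈V ∷ w⊆V) ∣V∣ = begin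
  count P? (y ∷ w)                         ≡⟨ count-∷ P? y w ⟩
  fromBool (P y) + count P? w              ≡⟨ cong (_+_ (fromBool (P y))) (count≡∣∩∣ P? (V ∖ y) w uw w⊆V∖y ∣V∖y∣) ⟩
  fromBool (P y) + ∣ P ∩ (V ∖ y) ∣         ≡⟨ cong₂ _+_ (cong fromBool head) (sum-cong-≗ λ z →
                                                cong fromBool (∧.x∙yz≈y∙xz (P z) (not (does (y ≟ z))) (V z))) ⟩
  fromBool ((P ∩ V) y) + ∣ P ∩ V ∖ y ∣     ≡⟨ ∣∣-∖ (P ∩ V) y ⟨
  ∣ P ∩ V ∣                                ∎
  where
  P = does ∘ P?
  w⊆V∖y = Equivalence.from (All-∖ V y w) (y∉w , w⊆V)
  ∣V∖y∣ = suc-injective (trans (sym (∣∣-∖-∈ V y∈V)) ∣V∣)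
  head : P y ≡ P y ∧ V y
  head = trans (sym (∧-identityʳ (P y))) (cong (P y ∧_) (sym (Equivalence.to T-≡ y∈V)))

rank-∖ : ∀ {n} (U : Subset n) x → rank (U ∖ x) x ≡ rank U x
rank-∖ U x = sum-cong-≗ λ y → cong fromBool (below-∖ y)
  where
  below-∖ : ∀ y → does (y <? x) ∧ (U ∖ x) y ≡ does (y <? x) ∧ U y
  below-∖ y = by-cases (y <? x)
    where
    by-cases : (y<x? : Dec (y < x)) → does y<x? ∧ (U ∖ x) y ≡ does y<x? ∧ U y
    by-cases (no  _)   = refl
    by-cases (yes y<x) = cong (λ b → not b ∧ U y) (dec-false (x ≟ y) (<⇒≢ y<x ∘ sym))

countBelow≡rank : ∀ {n k} (U : Subset n) {x} (w : Vec (Fin n) k) → ∣ U ∣ ≡ suc k → T (U x) →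
                  Unique w → All (T ∘ (U ∖ x)) w → countBelow x w ≡ rank U x
countBelow≡rank U {x} w ∣U∣ x∈U uw w⊆U∖x = trans
  (count≡∣∩∣ (_<? x) (U ∖ x) w uw w⊆U∖x (suc-injective (trans (sym (∣∣-∖-∈ U x∈U)) ∣U∣)))
  (rank-∖ U x)

arrangement-∷ : ∀ {n k} (U : Subset n) x (w : Vec (Fin n) k) → ∣ U ∣ ≡ suc k →
  Arrangement U (x ∷ w) ⇔ ((T (U x) × rank U x ℕ.< 2) × Arrangement (U ∖ x) w)
arrangement-∷ U x w ∣U∣ = mk⇔ to from
  where
  to : Arrangement U (x ∷ w) → (T (U x) × rank U x ℕ.< 2) × Arrangement (U ∖ x) w
  to (x∉w ∷ uw , x∈U ∷ w⊆U , c<2 , gw) =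
    (x∈U , subst (ℕ._< 2) (countBelow≡rank U w ∣U∣ x∈U uw w⊆U∖x) c<2) , uw , w⊆U∖x , gw
    where w⊆U∖x = Equivalence.from (All-∖ U x w) (x∉w , w⊆U)
  from : (T (U x) × rank U x ℕ.< 2) × Arrangement (U ∖ x) w → Arrangement U (x ∷ w)
  from ((x∈U , r<2) , uw , w⊆U∖x , gw) =
    let (x∉w , w⊆U) = Equivalence.to (All-∖ U x w) w⊆U∖x in
    x∉w ∷ uw , x∈U ∷ w⊆U , subst (ℕ._< 2) (sym (countBelow≡rank U w ∣U∣ x∈U uw w⊆U∖x)) r<2 , gw

card-arrangements : ∀ {n} k (U : Subset n) → ∣ U ∣ ≡ k → card k (does ∘ arrangement? U) ≡ 2 ^ (k ∸ 1)
card-arrangements     zero    U _   = refl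
card-arrangements {n} (suc k) U ∣U∣ = begin
  ∑[ x < n ] card k (λ w → does (arrangement? U (x ∷ w)))
    ≡⟨ sum-cong-≗ (λ x → card-cong k λ w →
         does-⇔ (arrangement-∷ U x w ∣U∣) (arrangement? U (x ∷ w)) (first? x ×-dec arrangement? (U ∖ x) w)) ⟩
  ∑[ x < n ] card k (λ w → L x ∧ does (arrangement? (U ∖ x) w))
    ≡⟨ sum-cong-≗ (λ x → card-∧ˡ k (L x) (does ∘ arrangement? (U ∖ x))) ⟩
  ∑[ x < n ] (fromBool (L x) * card k (does ∘ arrangement? (U ∖ x)))
    ≡⟨ sum-cong-≗ recurse ⟩
  ∑[ x < n ] (fromBool (L x) * 2 ^ (k ∸ 1))
    ≡⟨ *-distribʳ-sum (2 ^ (k ∸ 1)) (fromBool ∘ L) ⟨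
  ∣ L ∣ * 2 ^ (k ∸ 1)
    ≡⟨ cong (_* 2 ^ (k ∸ 1)) (trans (∣rank<∣ U 2) (cong (_⊓ 2) ∣U∣)) ⟩
  (suc k ⊓ 2) * 2 ^ (k ∸ 1)
    ≡⟨ double k ⟩
  2 ^ k ∎
  where
  L = U ∩ (λ x → rank U x <ᵇ 2)
  first? : ∀ x → Dec (T (U x) × rank U x ℕ.< 2)
  first? x = T? (U x) ×-dec rank U x ℕ.<? 2
  recurse : ∀ x → fromBool (L x) * card k (does ∘ arrangement? (U ∖ x)) ≡ fromBool (L x) * 2 ^ (k ∸ 1)
  recurse x with U x in x∈U
  ... | false = refl
  ... | true  = cong (fromBool (rank U x <ᵇ 2) *_) (card-arrangements k (U ∖ x)
                  (suc-injective (trans (sym (∣∣-∖-∈ U (Equivalence.from T-≡ x∈U))) ∣U∣)))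
  double : ∀ k → (suc k ⊓ 2) * 2 ^ (k ∸ 1) ≡ 2 ^ k
  double zero    = refl
  double (suc k) = cong (λ m → suc (suc m) * 2 ^ k) (⊓-zeroʳ k)

-- Occurrences in a word with a letter appended

module _ {n : ℕ} where

  Occurs : ∀ {k} → Vec (Fin n) k → Set
  Occurs {k} π =
    ∃ λ (i₁ : Fin k) → ∃ λ (i₂ : Fin k) → ∃ λ (i₃ : Fin k) → ∃ λ (i₄ : Fin k) →
      (i₁ < i₂) × (i₂ < i₃) × (i₃ < i₄) ×
      (lookup π i₂ < lookup π i₁) × (lookup π i₃ < lookup π i₁)

  BelowNotLast : ∀ {k} → Fin n → Vec (Fin n) k → Set
  BelowNotLast {k} x w = ∃ λ (j : Fin k) → ∃ λ (j′ : Fin k) → (j < j′) × (lookup w j < x)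

  TwoBelowNotLast : ∀ {k} → Fin n → Vec (Fin n) k → Set
  TwoBelowNotLast {k} x w = ∃ λ (j : Fin k) → ∃ λ (j′ : Fin k) → ∃ λ (j″ : Fin k) →
    (j < j′) × (j′ < j″) × (lookup w j < x) × (lookup w j′ < x)

  belowNotLast-∷ : ∀ {k} x y (w : Vec (Fin n) k) →
    ((y < x × 0 ℕ.< k) ⊎ BelowNotLast x w) ⇔ BelowNotLast x (y ∷ w)
  belowNotLast-∷ x y w = mk⇔ from to
    where
    to : BelowNotLast x (y ∷ w) → (y < x × 0 ℕ.< _) ⊎ BelowNotLast x w
    to (zero  , suc j′ , _      , y<x) = inj₁ (y<x , ≤-<-trans z≤n (toℕ<n j′))
    to (suc j , suc j′ , s≤s j<j′ , p) = inj₂ (j , j′ , j<j′ , p)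
    from : (y < x × 0 ℕ.< _) ⊎ BelowNotLast x w → BelowNotLast x (y ∷ w)
    from (inj₁ (y<x , 0<k))         = zero , suc (fromℕ< 0<k) , s≤s z≤n , y<x
    from (inj₂ (j , j′ , j<j′ , p)) = suc j , suc j′ , s≤s j<j′ , p

  twoBelowNotLast-∷ : ∀ {k} x y (w : Vec (Fin n) k) →
    ((y < x × BelowNotLast x w) ⊎ TwoBelowNotLast x w) ⇔ TwoBelowNotLast x (y ∷ w)
  twoBelowNotLast-∷ x y w = mk⇔ from to
    where
    to : TwoBelowNotLast x (y ∷ w) → (y < x × BelowNotLast x w) ⊎ TwoBelowNotLast x w
    to (zero  , suc j′ , suc j″ , _ , s≤s j′<j″ , y<x , p) = inj₁ (y<x , j′ , j″ , j′<j″ , p)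
    to (suc j , suc j′ , suc j″ , s≤s j<j′ , s≤s j′<j″ , p , q) =
      inj₂ (j , j′ , j″ , j<j′ , j′<j″ , p , q)
    from : (y < x × BelowNotLast x w) ⊎ TwoBelowNotLast x w → TwoBelowNotLast x (y ∷ w)
    from (inj₁ (y<x , j′ , j″ , j′<j″ , p)) =
      zero , suc j′ , suc j″ , s≤s z≤n , s≤s j′<j″ , y<x , p
    from (inj₂ (j , j′ , j″ , j<j′ , j′<j″ , p , q)) =
      suc j , suc j′ , suc j″ , s≤s j<j′ , s≤s j′<j″ , p , q

  occurs-∷ : ∀ {k} x (w : Vec (Fin n) k) → (TwoBelowNotLast x w ⊎ Occurs w) ⇔ Occurs (x ∷ w)
  occurs-∷ x w = mk⇔ from to
    where
    to : Occurs (x ∷ w) → TwoBelowNotLast x w ⊎ Occurs w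
    to (zero , suc i₂ , suc i₃ , suc i₄ , _ , s≤s p , s≤s q , r , s) =
      inj₁ (i₂ , i₃ , i₄ , p , q , r , s)
    to (suc i₁ , suc i₂ , suc i₃ , suc i₄ , s≤s o , s≤s p , s≤s q , r , s) =
      inj₂ (i₁ , i₂ , i₃ , i₄ , o , p , q , r , s)
    from : TwoBelowNotLast x w ⊎ Occurs w → Occurs (x ∷ w)
    from (inj₁ (i₂ , i₃ , i₄ , p , q , r , s)) =
      zero , suc i₂ , suc i₃ , suc i₄ , s≤s z≤n , s≤s p , s≤s q , r , s
    from (inj₂ (i₁ , i₂ , i₃ , i₄ , o , p , q , r , s)) =
      suc i₁ , suc i₂ , suc i₃ , suc i₄ , s≤s o , s≤s p , s≤s q , r , s

  -- Unlike occurrence?, these decide by recursion on the word, so that their verdict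
  -- on w ∷ʳ l can be computed from w.
  belowNotLast? : ∀ {k} x (w : Vec (Fin n) k) → Dec (BelowNotLast x w)
  belowNotLast? x []      = no λ ()
  belowNotLast? x (y ∷ w) =
    map-dec (belowNotLast-∷ x y w) ((y <? x ×-dec 0 ℕ.<? _) ⊎-dec belowNotLast? x w)

  twoBelowNotLast? : ∀ {k} x (w : Vec (Fin n) k) → Dec (TwoBelowNotLast x w)
  twoBelowNotLast? x []      = no λ ()
  twoBelowNotLast? x (y ∷ w) =
    map-dec (twoBelowNotLast-∷ x y w) ((y <? x ×-dec belowNotLast? x w) ⊎-dec twoBelowNotLast? x w)

  occurs? : ∀ {k} (w : Vec (Fin n) k) → Dec (Occurs w)
  occurs? []      = no λ ()
  occurs? (x ∷ w) = map-dec (occurs-∷ x w) (twoBelowNotLast? x w ⊎-dec occurs? w)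

  belowNotLast?-∷ʳ : ∀ {k} x l (w : Vec (Fin n) k) →
                     does (belowNotLast? x (w ∷ʳ l)) ≡ (0 <ᵇ countBelow x w)
  belowNotLast?-∷ʳ x l []      = trans (∨-identityʳ _) (∧-zeroʳ (does (l <? x)))
  belowNotLast?-∷ʳ x l (y ∷ w) with does (y <? x)
  ... | true  = refl
  ... | false = belowNotLast?-∷ʳ x l w

  twoBelowNotLast?-∷ʳ : ∀ {k} x l (w : Vec (Fin n) k) →
                        does (twoBelowNotLast? x (w ∷ʳ l)) ≡ not (countBelow x w <ᵇ 2)
  twoBelowNotLast?-∷ʳ x l []      = trans (∨-identityʳ _) (∧-zeroʳ (does (l <? x)))
  twoBelowNotLast?-∷ʳ x l (y ∷ w)
    rewrite belowNotLast?-∷ʳ x l w | twoBelowNotLast?-∷ʳ x l w with does (y <? x) | countBelow x w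
  ... | true  | zero  = refl
  ... | true  | suc _ = refl
  ... | false | _     = refl

  occurs?-∷ʳ : ∀ {k} l (w : Vec (Fin n) k) → does (occurs? (w ∷ʳ l)) ≡ not (does (atMostOneBelow? w))
  occurs?-∷ʳ l []      = refl
  occurs?-∷ʳ l (x ∷ w) = begin
    does (twoBelowNotLast? x (w ∷ʳ l)) ∨ does (occurs? (w ∷ʳ l))
      ≡⟨ cong₂ _∨_ (twoBelowNotLast?-∷ʳ x l w) (occurs?-∷ʳ l w) ⟩
    not (countBelow x w <ᵇ 2) ∨ not (does (atMostOneBelow? w))
      ≡⟨ deMorgan₁ (countBelow x w <ᵇ 2) (does (atMostOneBelow? w)) ⟨
    not ((countBelow x w <ᵇ 2) ∧ does (atMostOneBelow? w)) ∎

  all?-∷ʳ : ∀ {k} {P : Pred (Fin n) 0ℓ} (P? : Decidable P) l (w : Vec (Fin n) k) →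
            does (all? P? (w ∷ʳ l)) ≡ does (all? P? w) ∧ does (P? l)
  all?-∷ʳ P? l []      = ∧-identityʳ (does (P? l))
  all?-∷ʳ P? l (y ∷ w) =
    trans (cong (does (P? y) ∧_) (all?-∷ʳ P? l w)) (sym (∧-assoc (does (P? y)) _ _))

  unique?-∷ʳ : ∀ {k} l (w : Vec (Fin n) k) →
               does (unique? (w ∷ʳ l)) ≡ does (unique? w) ∧ does (all? (T? ∘ (full ∖ l)) w)
  unique?-∷ʳ l []      = refl
  unique?-∷ʳ l (x ∷ w) = begin
    does (all? (λ y → ¬? (x ≟ y)) (w ∷ʳ l)) ∧ does (unique? (w ∷ʳ l))
                               ≡⟨ cong₂ _∧_ (all?-∷ʳ (λ y → ¬? (x ≟ y)) l w) (unique?-∷ʳ l w) ⟩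
    (x∉w ∧ x≢l) ∧ (uw ∧ w∌l)  ≡⟨ ∧.interchange x∉w x≢l uw w∌l ⟩
    (x∉w ∧ uw) ∧ (x≢l ∧ w∌l)  ≡⟨ cong (λ b → (x∉w ∧ uw) ∧ (b ∧ w∌l)) x≢l≡ ⟩
    (x∉w ∧ uw) ∧ ((full ∖ l) x ∧ w∌l) ∎
    where
    x∉w = does (all? (λ y → ¬? (x ≟ y)) w)
    x≢l = not (does (x ≟ l))
    uw  = does (unique? w)
    w∌l = does (all? (T? ∘ (full ∖ l)) w)
    x≢l≡ : x≢l ≡ (full ∖ l) x
    x≢l≡ = trans (cong not (does-⇔ (mk⇔ sym sym) (x ≟ l) (l ≟ x))) (sym (∧-identityʳ _))

permAvoiding? : ∀ {n} (π : Vec (Fin n) n) → Dec (IsPerm π × Avoids π)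
permAvoiding? π = isPerm? π ×-dec ¬? (occurrence? π)

IsPerm⇔Unique : ∀ {n} (π : Vec (Fin n) n) → IsPerm π ⇔ Unique π
IsPerm⇔Unique π = mk⇔
  (λ inj → subst Unique (tabulate∘lookup π) (tabulate⁺ λ {i} {j} → inj i j))
  lookup-injective

avoiding-∷ʳ : ∀ {m} l (w : Vec (Fin (suc m)) m) →
  does (permAvoiding? (w ∷ʳ l)) ≡ does (arrangement? (full ∖ l) w)
avoiding-∷ʳ l w = begin
  does (isPerm? π) ∧ not (does (occurrence? π))
    ≡⟨ cong₂ (λ p o → p ∧ not o) (does-⇔ (IsPerm⇔Unique π) (isPerm? π) (unique? π))
                                 (does-≡ (occurrence? π) (occurs? π)) ⟩
  does (unique? π) ∧ not (does (occurs? π))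
    ≡⟨ cong₂ (λ p o → p ∧ not o) (unique?-∷ʳ l w) (occurs?-∷ʳ l w) ⟩
  (does (unique? w) ∧ does (all? (T? ∘ (full ∖ l)) w)) ∧ not (not (does (atMostOneBelow? w)))
    ≡⟨ cong (_∧_ (does (unique? w) ∧ does (all? (T? ∘ (full ∖ l)) w))) (not-involutive (does (atMostOneBelow? w))) ⟩
  (does (unique? w) ∧ does (all? (T? ∘ (full ∖ l)) w)) ∧ does (atMostOneBelow? w)
    ≡⟨ ∧-assoc (does (unique? w)) _ _ ⟩
  does (arrangement? (full ∖ l) w) ∎
  where π = w ∷ʳ l

a-suc : ∀ m → a (suc m) ≡ suc m * 2 ^ (m ∸ 1)
a-suc m = begin
  a (suc m)
    ≡⟨ length-filter-allVecs (suc m) (suc m) permAvoiding? ⟩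
  card (suc m) (does ∘ permAvoiding?)
    ≡⟨ card-∷ʳ m (does ∘ permAvoiding?) ⟩
  ∑[ l < suc m ] card m (λ w → does (permAvoiding? (w ∷ʳ l)))
    ≡⟨ sum-cong-≗ (λ l → card-cong m (avoiding-∷ʳ l)) ⟩
  ∑[ l < suc m ] card m (does ∘ arrangement? (full ∖ l))
    ≡⟨ sum-cong-≗ (λ l → card-arrangements m (full ∖ l) (∣full∖∣ l)) ⟩
  ∑[ l < suc m ] (2 ^ (m ∸ 1))
    ≡⟨ ∑-const (suc m) (2 ^ (m ∸ 1)) ⟩
  suc m * 2 ^ (m ∸ 1) ∎
  where
  ∣full∖∣ : ∀ l → ∣ full ∖ l ∣ ≡ m
  ∣full∖∣ l = suc-injective (trans (sym (∣∣-∖-∈ full {l} tt)) (∣full∣ (suc m)))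

-- The generating function

foldr-map-applyUpTo-zero : ∀ (g : ℕ → ℤ) (f : ℕ → ℕ) n → (∀ i → g (f i) ≡ + 0) →
                           foldr ℤ._+_ (+ 0) (map g (applyUpTo f n)) ≡ + 0
foldr-map-applyUpTo-zero g f zero    g∘f≡0 = refl
foldr-map-applyUpTo-zero g f (suc n) g∘f≡0 =
  cong₂ ℤ._+_ (g∘f≡0 0) (foldr-map-applyUpTo-zero g (f ∘ suc) n (g∘f≡0 ∘ suc))

⊛-quadratic : ∀ c₀ c₁ c₂ (f : FPS) n →
  (poly (c₀ ∷ c₁ ∷ c₂ ∷ []) ⊛ f) (2 + n) ≡ c₀ ℤ.* f (2 + n) ℤ.+ c₁ ℤ.* f (1 + n) ℤ.+ c₂ ℤ.* f n
⊛-quadratic c₀ c₁ c₂ f n = trans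
  (cong (λ t → c₀ ℤ.* f (2 + n) ℤ.+ (c₁ ℤ.* f (1 + n) ℤ.+ (c₂ ℤ.* f n ℤ.+ t)))
        (foldr-map-applyUpTo-zero _ _ n λ _ → refl))
  (reassociate (c₀ ℤ.* f (2 + n)) (c₁ ℤ.* f (1 + n)) (c₂ ℤ.* f n))
  where
  reassociate : ∀ x y z → x ℤ.+ (y ℤ.+ (z ℤ.+ + 0)) ≡ x ℤ.+ y ℤ.+ z
  reassociate = ℤ-Solver.solve-∀

a-recurrence : ∀ m → a (4 + m) + 4 * a (2 + m) ≡ 4 * a (3 + m)
a-recurrence m = trans (cong₂ (λ p q → p + 4 * q) (a-suc (3 + m)) (a-suc (1 + m)))
                       (trans (identity m (2 ^ m)) (cong (4 *_) (sym (a-suc (2 + m)))))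
  where
  identity : ∀ m t → (4 + m) * (2 * (2 * t)) + 4 * ((2 + m) * t) ≡ 4 * ((3 + m) * (2 * t))
  identity = ℕ-Solver.solve-∀

recurrence-ℤ : ∀ x y z → x + 4 * z ≡ 4 * y →
                      + 1 ℤ.* + x ℤ.+ -[1+ 3 ] ℤ.* + y ℤ.+ + 4 ℤ.* + z ≡ + 0
recurrence-ℤ x y z x+4z≡4y = begin
  + 1 ℤ.* + x ℤ.+ -[1+ 3 ] ℤ.* + y ℤ.+ + 4 ℤ.* + z  ≡⟨ regroup (+ x) (+ y) (+ z) ⟩
  (+ x ℤ.+ + 4 ℤ.* + z) ℤ.- + 4 ℤ.* + y             ≡⟨ cong (ℤ._- + 4 ℤ.* + y) balanced ⟩
  + 4 ℤ.* + y ℤ.- + 4 ℤ.* + y                       ≡⟨ ℤ.+-inverseʳ (+ 4 ℤ.* + y) ⟩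
  + 0                                               ∎
  where
  regroup : ∀ x y z → + 1 ℤ.* x ℤ.+ -[1+ 3 ] ℤ.* y ℤ.+ + 4 ℤ.* z ≡ (x ℤ.+ + 4 ℤ.* z) ℤ.- + 4 ℤ.* y
  regroup = ℤ-Solver.solve-∀
  balanced : + x ℤ.+ + 4 ℤ.* + z ≡ + 4 ℤ.* + y
  balanced = trans (cong (ℤ._+_ (+ x)) (sym (ℤ.pos-* 4 z))) (trans (cong +_ x+4z≡4y) (ℤ.pos-* 4 y))

theorem10 : (a 0 ≡ 1) × (a 1 ≡ 1) × (∀ n → 2 ≤ n → a n ≡ n * 2 ^ (n ∸ 2)) ×
    (∀ n → (poly (+ 1 ∷ -[1+ 3 ] ∷ + 4 ∷ []) ⊛ A) n ≡ poly (+ 1 ∷ -[1+ 2 ] ∷ + 2 ∷ + 2 ∷ []) n)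
theorem10 = refl , refl , closed-form , generating-function
  where
  closed-form : ∀ n → 2 ≤ n → a n ≡ n * 2 ^ (n ∸ 2)
  closed-form (suc zero)    (s≤s ())
  closed-form (suc (suc k)) _ = a-suc (suc k)
  generating-function : ∀ n → (poly (+ 1 ∷ -[1+ 3 ] ∷ + 4 ∷ []) ⊛ A) n ≡ poly (+ 1 ∷ -[1+ 2 ] ∷ + 2 ∷ + 2 ∷ []) n
  generating-function 0 = refl
  generating-function 1 = refl
  generating-function 2 = refl
  generating-function 3 = refl
  generating-function (suc (suc (suc (suc m)))) =
    trans (⊛-quadratic (+ 1) -[1+ 3 ] (+ 4) A (2 + m))
          (recurrence-ℤ (a (4 + m)) (a (3 + m)) (a (2 + m)) (a-recurrence m))
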